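{- The acyclic commerge problem for $\mathcal{T}_{\mathrm{cat}}$ is decidable for any tuple of embeddings.
   Context: Quivers are finite directed multigraphs $Q=(V_Q,A_Q,s_Q,t_Q)$ with $V_Q,A_Q$ finite subsets of $\mathbb N$. A quiver is acyclic if every path in it (a quiver morphism from a path-quiver $0\to 1\to\cdots\to k$) is an embedding, i.e. injective on vertices and arrows. An embedding of quivers is a morphism that is injective on vertices and on arrows. $\Sigma$ is the many-sorted signature whose sorts are the finite acyclic quivers, with one function symbol $\mathrm{restr}_m$ of arity $Q\to Q'$ for each embedding $m\colon Q'\hookrightarrow Q$ of acyclic quivers, and one predicate $\mathrm{commute}_Q$ on sort $Q$ for each finite acyclic quiver $Q$. A small category $\mathcal C$ gives an interpretation of $\Sigma$ (its categorical interpretation): sort $Q$ is interpreted as the set of diagrams in $\mathcal C$ over $Q$ (functors from the free category on $Q$ to $\mathcal C$), $\mathrm{restr}_m$ as pullback $D\mapsto D\circ\Phi_m$ (where $\Phi_m$ is the functor induced by $m$ on free categories), and $\mathrm{commute}_Q$ as the set of commutative diagrams over $Q$ (any two paths with the same extremities have equal composites). $\mathcal{T}_{\mathrm{cat}}$ is a first-order theory over $\Sigma$ whose models are exactly, up to isomorphism, these categorical interpretations of small categories. Let $Q$ be an acyclic quiver, $k\in\mathbb N$, and for each $i\in\{0,\dots,k-1\}$ let $Q_i$ be an acyclic quiver and $m_i\colon Q_i\hookrightarrow Q$ an embedding. Define the formula $\mathrm{Commerge}_{m_0,\dots,m_{k-1}}\colon\ \forall_Q x,\ \bigwedge_{i=0}^{k-1}\mathrm{commute}(\mathrm{restr}_{m_i}(x))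 \to \mathrm{commute}(x)$. The acyclic commerge problem for $m_0,\dots,m_{k-1}$ and $\mathcal{T}_{\mathrm{cat}}$ is the problem of deciding whether this formula is valid among all models of $\Sigma$ satisfying $\mathcal{T}_{\mathrm{cat}}$. -}

module Defs where

open import Data.Nat using (ℕ)
open import Data.Fin using (Fin)
open import Data.List using (List; []; _∷_)
open import Data.List.Relation.Unary.Unique.Propositional using (Unique)
open import Data.Product using (Σ; proj₁)
open import Relation.Binary.PropositionalEquality using (_≡_; cong; subst₂)
open import Relation.Nullary using (Dec)
open import Function.Definitions using (Injective)

-- Finite quivers (vertices / arrows enumerated by Fin; isomorphism-
-- invariant presentation of finite subsets of ℕ)

record Quiver : Set where
  field
    nV  : ℕ
    nA  : ℕ
    src : Fin nA → Fin nV
    tgt : Fin nA → Fin nV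
open Quiver public

-- Paths in Q from vertex v to vertex w (morphisms from a path quiver).
data Path (Q : Quiver) : Fin (nV Q) → Fin (nV Q) → Set where
  nil  : (v : Fin (nV Q)) → Path Q v v
  cons : ∀ {w} (a : Fin (nA Q)) → Path Q (tgt Q a) w → Path Q (src Q a) w

pathVertices : ∀ {Q v w} → Path Q v w → List (Fin (nV Q))
pathVertices (nil v)    = v ∷ []
pathVertices {Q} (cons a p) = src Q a ∷ pathVertices p

pathArrows : ∀ {Q v w} → Path Q v w → List (Fin (nA Q))
pathArrows (nil v)    = []
pathArrows (cons a p) = a ∷ pathArrows p

IsEmbeddingPath : ∀ {Q v w} → Path Q v w → Set
IsEmbeddingPath p = Σ (Unique (pathVertices p)) (λ _ → Unique (pathArrows p))

Acyclic : Quiver → Set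
Acyclic Q = ∀ {v w} (p : Path Q v w) → IsEmbeddingPath p

AcyclicQuiver : Set
AcyclicQuiver = Σ Quiver Acyclic

record Embedding (Q' Q : Quiver) : Set where
  field
    vmap   : Fin (nV Q') → Fin (nV Q)
    amap   : Fin (nA Q') → Fin (nA Q)
    vinj   : Injective _≡_ _≡_ vmap
    ainj   : Injective _≡_ _≡_ amap
    src-eq : ∀ a → src Q (amap a) ≡ vmap (src Q' a)
    tgt-eq : ∀ a → tgt Q (amap a) ≡ vmap (tgt Q' a)
open Embedding public

record Category : Set₁ where
  infixr 9 _∘_
  field
    Obj  : Set
    Hom  : Obj → Obj → Set
    id   : ∀ {A} → Hom A A
    _∘_  : ∀ {A B C} → Hom B C → Hom A B → Hom A C
    assoc : ∀ {A B C D} (f : Hom A B) (g : Hom B C) (h : Hom C D) →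
            (h ∘ g) ∘ f ≡ h ∘ (g ∘ f)
    idˡ  : ∀ {A B} (f : Hom A B) → id ∘ f ≡ f
    idʳ  : ∀ {A B} (f : Hom A B) → f ∘ id ≡ f
open Category public

-- Diagrams over Q in C (= functors from the free category on Q to C,
-- which are determined freely by their values on vertices and arrows).
record Diagram (C : Category) (Q : Quiver) : Set where
  field
    obj : Fin (nV Q) → Obj C
    arr : (a : Fin (nA Q)) → Hom C (obj (src Q a)) (obj (tgt Q a))
open Diagram public

composite : ∀ {C Q} (D : Diagram C Q) {v w} → Path Q v w →
            Hom C (obj D v) (obj D w)
composite {C} D (nil v)    = id C
composite {C} D (cons a p) = _∘_ C (composite D p) (arr D a)

Commutes : ∀ {C Q} → Diagram C Q → Set
Commutes {C} {Q} D = ∀ {v w} (p q : Path Q v w) → composite D p ≡ composite D q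

restr : ∀ {C Q' Q} → Embedding Q' Q → Diagram C Q → Diagram C Q'
restr {C} {Q'} {Q} m D = record
  { obj = λ v → obj D (vmap m v)
  ; arr = λ a → subst₂ (Hom C) (cong (obj D) (src-eq m a))
                                (cong (obj D) (tgt-eq m a)) (arr D (amap m a))
  }

CommergeHoldsIn : (C : Category) {Q : Quiver} {k : ℕ} {Qs : Fin k → Quiver}
                  (ms : (i : Fin k) → Embedding (Qs i) Q) → Set
CommergeHoldsIn C {Q} ms =
  (x : Diagram C Q) → (∀ i → Commutes (restr (ms i) x)) → Commutes x

-- Validity among all models of T_cat (= categorical interpretations of
-- small categories, up to isomorphism).
CommergeValid : {Q : Quiver} {k : ℕ} {Qs : Fin k → Quiver}
                (ms : (i : Fin k) → Embedding (Qs i) Q) → Set₁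
CommergeValid ms = (C : Category) → CommergeHoldsIn C ms

-- Let ≈ be the congruence on the paths of Q generated by the pairs (m_i p′, m_i q′) of images
-- of parallel paths of the Q_i. Commerge holds in every category iff any two parallel paths of
-- Q are ≈-related: one direction because functors respect ≈, the other by testing the formula
-- on the canonical diagram in the free category on Q modulo ≈. Since Q and the Q_i are acyclic,
-- paths have length below the number of vertices, so there are finitely many of them and ≈ is
-- decidable, being reachability in a finite graph.
module Submission where

open import Defs
open import Level using (0ℓ)
open import Data.Nat as ℕ using (ℕ; zero; suc; _≤_; _<_; s≤s)
open import Data.Nat.Properties using (≰⇒>; <⇒≤)
open import Data.Fin as Fin using (Fin; _≟_)
open import Data.Fin.Properties using (pigeonhole; any?; all?)
open import Data.List as List using (List; []; _∷_; concatMap; allFin; lookup)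
open import Data.List.Membership.Propositional using (_∈_; lose)
open import Data.List.Membership.Propositional.Properties
  using (∈-allFin; ∈-concat⁺′; ∈-map⁺; ∈-++⁺ˡ; ∈-++⁺ʳ; ∈-lookup)
open import Data.List.Relation.Unary.Any using (here; there; satisfied)
import Data.List.Relation.Unary.Any as Any
open import Data.List.Relation.Unary.All as All using (All)
open import Data.List.Relation.Unary.AllPairs using (_∷_)
open import Data.List.Relation.Unary.Unique.Propositional using (Unique)
open import Data.List.Relation.Unary.Enumerates.Setoid using (IsEnumeration)
open import Data.Product using (Σ; Σ-syntax; ∃; ∃-syntax; _,_; proj₁; proj₂; _×_)
open import Data.Sum using (_⊎_; inj₁; inj₂; [_,_])
open import Data.Empty using (⊥-elim)
open import Relation.Nullary using (Dec; yes; no)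
open import Relation.Nullary.Decidable using (map′; _×-dec_; _⊎-dec_)
open import Relation.Unary using (Pred)
import Relation.Unary as U
open import Relation.Binary.Core using (Rel)
open import Relation.Binary.Definitions using (Decidable; DecidableEquality)
open import Relation.Binary.Structures using (IsEquivalence)
open import Relation.Binary.Construct.Closure.ReflexiveTransitive using (Star; ε; _◅_; _◅◅_)
open import Relation.Binary.Construct.Closure.Symmetric using (SymClosure; fwd; bwd)
open import Relation.Binary.Construct.Closure.Equivalence as EqClosure using (EqClosure)
open import Relation.Binary.PropositionalEquality
  using (_≡_; _≢_; refl; sym; trans; cong; subst; subst₂; setoid; isEquivalence; module ≡-Reasoning)
open import Axiom.UniquenessOfIdentityProofs using (module Decidable⇒UIP)

Enumerated : Set → Set
Enumerated A = Σ (List A) (IsEnumeration (setoid A))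

module _ {A : Set} {P : Pred A 0ℓ} (enum : Enumerated A) (P? : U.Decidable P) where

  ∃-enumerated? : Dec (∃ P)
  ∃-enumerated? = map′ satisfied (λ (x , px) → lose (proj₂ enum x) px) (Any.any? P? (proj₁ enum))

  ∀-enumerated? : Dec (∀ x → P x)
  ∀-enumerated? = map′ (λ all x → All.lookup all (proj₂ enum x)) (λ f → All.tabulate λ {x} _ → f x)
                       (All.all? P? (proj₁ enum))

Unique⇒length≤ : ∀ {n} {xs : List (Fin n)} → Unique xs → List.length xs ≤ n
Unique⇒length≤ {n} {xs} unique with List.length xs ℕ.≤? n
... | yes bounded = bounded
... | no unbounded with pigeonhole (≰⇒> unbounded) (lookup xs)
...   | i , j , i<j , collision = ⊥-elim (lookup-distinct unique i j i<j collision)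
  where
  lookup-distinct : ∀ {ys : List (Fin n)} → Unique ys →
                    (i j : Fin (List.length ys)) → i Fin.< j → lookup ys i ≢ lookup ys j
  lookup-distinct (y∉ys ∷ _) Fin.zero (Fin.suc j) _ = All.lookup y∉ys (∈-lookup j)
  lookup-distinct (_ ∷ unique) (Fin.suc i) (Fin.suc j) (s≤s i<j) = lookup-distinct unique i j i<j

-- Floyd–Warshall: `Via S x y` holds when an R-chain of positive length leads from x to y
-- through intermediate points in S only.
module FiniteReachability {A : Set} (_≟ᴬ_ : DecidableEquality A)
                          {R : Rel A 0ℓ} (R? : Decidable R) where

  data Via (S : List A) : Rel A 0ℓ where
    direct : ∀ {x y} → R x y → Via S x y
    _⟶⟨_⟩_ : ∀ {x y z} → R x y → y ∈ S → Via S y z → Via S x z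

  via-weaken : ∀ {s S x y} → Via S x y → Via (s ∷ S) x y
  via-weaken (direct r)         = direct r
  via-weaken (r ⟶⟨ y∈S ⟩ chain) = r ⟶⟨ there y∈S ⟩ via-weaken chain

  via-trans : ∀ {S x y z} → Via S x y → y ∈ S → Via S y z → Via S x z
  via-trans (direct r)        y∈S rest = r ⟶⟨ y∈S ⟩ rest
  via-trans (r ⟶⟨ m ⟩ chain) y∈S rest = r ⟶⟨ m ⟩ via-trans chain y∈S rest

  via-∷⁻ : ∀ {s S x y} → Via (s ∷ S) x y → Via S x y ⊎ (Via S x s × (s ≡ y ⊎ Via S s y))
  via-∷⁻ (direct r) = inj₁ (direct r)
  via-∷⁻ (r ⟶⟨ here refl ⟩ chain) with via-∷⁻ chain
  ... | inj₁ rest       = inj₂ (direct r , inj₂ rest)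
  ... | inj₂ (_ , rest) = inj₂ (direct r , rest)
  via-∷⁻ (r ⟶⟨ there y∈S ⟩ chain) with via-∷⁻ chain
  ... | inj₁ rest            = inj₁ (r ⟶⟨ y∈S ⟩ rest)
  ... | inj₂ (toS , fromS)   = inj₂ ((r ⟶⟨ y∈S ⟩ toS) , fromS)

  via-∷⁺ : ∀ {s S x y} → Via S x y ⊎ (Via S x s × (s ≡ y ⊎ Via S s y)) → Via (s ∷ S) x y
  via-∷⁺ (inj₁ chain)               = via-weaken chain
  via-∷⁺ (inj₂ (toS , inj₁ refl))   = via-weaken toS
  via-∷⁺ (inj₂ (toS , inj₂ fromS)) = via-trans (via-weaken toS) (here refl) (via-weaken fromS)

  via? : ∀ S → Decidable (Via S)
  via? [] x y = map′ direct (λ { (direct r) → r ; (_ ⟶⟨ () ⟩ _) }) (R? x y)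
  via? (s ∷ S) x y =
    map′ via-∷⁺ via-∷⁻ (via? S x y ⊎-dec (via? S x s ×-dec ((s ≟ᴬ y) ⊎-dec via? S s y)))

  via⇒star : ∀ {S x y} → Via S x y → Star R x y
  via⇒star (direct r)      = r ◅ ε
  via⇒star (r ⟶⟨ _ ⟩ chain) = r ◅ via⇒star chain

  star? : Enumerated A → Decidable (Star R)
  star? (xs , xs-complete) x y =
    map′ [ refl⇒star , via⇒star ] star⇒via ((x ≟ᴬ y) ⊎-dec via? xs x y)
    where
    refl⇒star : ∀ {x y} → x ≡ y → Star R x y
    refl⇒star refl = ε

    star⇒via : ∀ {x y} → Star R x y → x ≡ y ⊎ Via xs x y
    star⇒via ε = inj₁ refl
    star⇒via (r ◅ rs) with star⇒via rs
    ... | inj₁ refl  = inj₂ (direct r)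
    ... | inj₂ chain = inj₂ (r ⟶⟨ xs-complete _ ⟩ chain)

module CanonicalRepresentative {A : Set} {_≈_ : Rel A 0ℓ} (≈-equivalence : IsEquivalence _≈_)
                               (_≈?_ : Decidable _≈_) (enum : Enumerated A) where
  open IsEquivalence ≈-equivalence renaming (refl to ≈-refl; sym to ≈-sym; trans to ≈-trans)

  firstRelated : List A → A → A
  firstRelated []       x = x
  firstRelated (y ∷ ys) x with y ≈? x
  ... | yes _ = y
  ... | no  _ = firstRelated ys x

  firstRelated-≈ : ∀ ys x → firstRelated ys x ≈ x
  firstRelated-≈ []       x = ≈-refl
  firstRelated-≈ (y ∷ ys) x with y ≈? x
  ... | yes y≈x = y≈x
  ... | no  _   = firstRelated-≈ ys x

  firstRelated-resp-≈ : ∀ {ys x z} → x ∈ ys → x ≈ z → firstRelated ys x ≡ firstRelated ys z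
  firstRelated-resp-≈ {y ∷ ys} {x} {z} x∈ys x≈z with y ≈? x | y ≈? z
  ... | yes _   | yes _   = refl
  ... | yes y≈x | no  y≉z = ⊥-elim (y≉z (≈-trans y≈x x≈z))
  ... | no  y≉x | yes y≈z = ⊥-elim (y≉x (≈-trans y≈z (≈-sym x≈z)))
  ... | no  y≉x | no  _   with x∈ys
  ...   | here refl  = ⊥-elim (y≉x ≈-refl)
  ...   | there x∈ys′ = firstRelated-resp-≈ x∈ys′ x≈z

  canon : A → A
  canon = firstRelated (proj₁ enum)

  canon-≈ : ∀ x → canon x ≈ x
  canon-≈ = firstRelated-≈ (proj₁ enum)

  ≈⇒canon-≡ : ∀ {x y} → x ≈ y → canon x ≡ canon y
  ≈⇒canon-≡ = firstRelated-resp-≈ (proj₂ enum _)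

module Paths {Q : Quiver} where

  infixr 5 _++ₚ_
  _++ₚ_ : ∀ {u v w} → Path Q u v → Path Q v w → Path Q u w
  nil _    ++ₚ q = q
  cons a p ++ₚ q = cons a (p ++ₚ q)

  ++ₚ-assoc : ∀ {u v w z} (p : Path Q u v) (q : Path Q v w) (r : Path Q w z) →
              (p ++ₚ q) ++ₚ r ≡ p ++ₚ (q ++ₚ r)
  ++ₚ-assoc (nil _)    q r = refl
  ++ₚ-assoc (cons a p) q r = cong (cons a) (++ₚ-assoc p q r)

  ++ₚ-identityʳ : ∀ {u w} (p : Path Q u w) → p ++ₚ nil w ≡ p
  ++ₚ-identityʳ (nil _)    = refl
  ++ₚ-identityʳ (cons a p) = cong (cons a) (++ₚ-identityʳ p)

  pathLength : ∀ {u w} → Path Q u w → ℕ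
  pathLength (nil _)    = zero
  pathLength (cons _ p) = suc (pathLength p)

  length-pathVertices : ∀ {u w} (p : Path Q u w) → List.length (pathVertices p) ≡ suc (pathLength p)
  length-pathVertices (nil _)    = refl
  length-pathVertices (cons _ p) = cong suc (length-pathVertices p)

  acyclic⇒pathLength< : Acyclic Q → ∀ {u w} (p : Path Q u w) → pathLength p < nV Q
  acyclic⇒pathLength< acyclic p =
    subst (_≤ nV Q) (length-pathVertices p) (Unique⇒length≤ (proj₁ (acyclic p)))

  -- Comparing paths together with their sources avoids unifying the sources of two arrows.
  ≟-withSource : ∀ {u u′ w} (p : Path Q u w) (q : Path Q u′ w) →
                 Dec (_≡_ {A = ∃ λ v → Path Q v w} (u , p) (u′ , q))
  ≟-withSource (nil u)    (nil .u)   = yes refl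
  ≟-withSource (nil _)    (cons _ _) = no λ ()
  ≟-withSource (cons _ _) (nil _)    = no λ ()
  ≟-withSource (cons a p) (cons b q) with a ≟ b
  ... | no a≢b = no λ { refl → a≢b refl }
  ... | yes refl with ≟-withSource p q
  ...   | yes refl = yes refl
  ...   | no p≢q   = no λ { refl → p≢q refl }

  _≟ₚ_ : ∀ {u w} → DecidableEquality (Path Q u w)
  p ≟ₚ q with ≟-withSource p q
  ... | yes refl = yes refl
  ... | no p≢q   = no λ { refl → p≢q refl }

  trivialPaths : ∀ {u w} → Dec (u ≡ w) → List (Path Q u w)
  trivialPaths (yes refl) = nil _ ∷ []
  trivialPaths (no _)     = []

  pathsStartingWith : ∀ a {u w} → Dec (src Q a ≡ u) → List (Path Q (tgt Q a) w) → List (Path Q u w)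
  pathsStartingWith a (yes refl) ps = List.map (cons a) ps
  pathsStartingWith a (no _)     _  = []

  paths≤ : ℕ → ∀ u w → List (Path Q u w)
  paths≤ zero    u w = trivialPaths (u ≟ w)
  paths≤ (suc n) u w = trivialPaths (u ≟ w) List.++
    concatMap (λ a → pathsStartingWith a (src Q a ≟ u) (paths≤ n (tgt Q a) w)) (allFin (nA Q))

  nil∈trivialPaths : ∀ u (u≟u : Dec (u ≡ u)) → nil u ∈ trivialPaths u≟u
  nil∈trivialPaths u (yes refl) = here refl
  nil∈trivialPaths u (no u≢u)   = ⊥-elim (u≢u refl)

  cons∈pathsStartingWith : ∀ a {w} {p : Path Q (tgt Q a) w} {ps} (e : Dec (src Q a ≡ src Q a)) →
                           p ∈ ps → cons a p ∈ pathsStartingWith a e ps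
  cons∈pathsStartingWith a (yes refl) p∈ps = ∈-map⁺ (cons a) p∈ps
  cons∈pathsStartingWith a (no a≢a)   _    = ⊥-elim (a≢a refl)

  ∈-paths≤ : ∀ n {u w} (p : Path Q u w) → pathLength p ≤ n → p ∈ paths≤ n u w
  ∈-paths≤ zero    (nil u) _ = nil∈trivialPaths u (u ≟ u)
  ∈-paths≤ (suc n) (nil u) _ = ∈-++⁺ˡ (nil∈trivialPaths u (u ≟ u))
  ∈-paths≤ (suc n) {u} {w} (cons a p) (s≤s bound) =
    ∈-++⁺ʳ (trivialPaths (u ≟ w))
      (∈-concat⁺′ (cons∈pathsStartingWith a (src Q a ≟ src Q a) (∈-paths≤ n p bound))
                  (∈-map⁺ _ (∈-allFin a)))

  acyclic⇒paths-enumerated : Acyclic Q → ∀ u w → Enumerated (Path Q u w)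
  acyclic⇒paths-enumerated acyclic u w =
    paths≤ (nV Q) u w , λ p → ∈-paths≤ (nV Q) p (<⇒≤ (acyclic⇒pathLength< acyclic p))

open Paths

module _ {C : Category} {Q : Quiver} (x : Diagram C Q) where
  private
    _∘ᶜ_ : ∀ {A B D} → Hom C B D → Hom C A B → Hom C A D
    _∘ᶜ_ = _∘_ C

  composite-++ₚ : ∀ {u v w} (p : Path Q u v) (q : Path Q v w) →
                  composite x (p ++ₚ q) ≡ composite x q ∘ᶜ composite x p
  composite-++ₚ (nil _)    q = sym (idʳ C _)
  composite-++ₚ (cons a p) q = begin
    composite x (p ++ₚ q) ∘ᶜ arr x a              ≡⟨ cong (_∘ᶜ arr x a) (composite-++ₚ p q) ⟩
    (composite x q ∘ᶜ composite x p) ∘ᶜ arr x a   ≡⟨ assoc C _ _ _ ⟩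
    composite x q ∘ᶜ (composite x p ∘ᶜ arr x a)   ∎
    where open ≡-Reasoning

  composite-inContext : ∀ {u v v′ w} {r s : Path Q v v′} (a : Path Q u v) (b : Path Q v′ w) →
                        composite x r ≡ composite x s →
                        composite x (a ++ₚ r ++ₚ b) ≡ composite x (a ++ₚ s ++ₚ b)
  composite-inContext {r = r} {s} a b r≡s = begin
    composite x (a ++ₚ r ++ₚ b)                           ≡⟨ composite-++ₚ a _ ⟩
    composite x (r ++ₚ b) ∘ᶜ composite x a                ≡⟨ cong (_∘ᶜ composite x a) (composite-++ₚ r b) ⟩
    (composite x b ∘ᶜ composite x r) ∘ᶜ composite x a     ≡⟨ cong (λ g → (composite x b ∘ᶜ g) ∘ᶜ composite x a) r≡s ⟩
    (composite x b ∘ᶜ composite x s) ∘ᶜ composite x a     ≡⟨ cong (_∘ᶜ composite x a) (composite-++ₚ s b) ⟨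
    composite x (s ++ₚ b) ∘ᶜ composite x a                ≡⟨ composite-++ₚ a _ ⟨
    composite x (a ++ₚ s ++ₚ b)                           ∎
    where open ≡-Reasoning

module _ {Q′ Q : Quiver} (m : Embedding Q′ Q) where

  private
    consAlong : ∀ a {v t w} → src Q a ≡ v → tgt Q a ≡ t → Path Q t w → Path Q v w
    consAlong a refl refl p = cons a p

  mapPath : ∀ {v w} → Path Q′ v w → Path Q (vmap m v) (vmap m w)
  mapPath (nil v)    = nil (vmap m v)
  mapPath (cons a p) = consAlong (amap m a) (src-eq m a) (tgt-eq m a) (mapPath p)

  composite-restr : ∀ {C} (x : Diagram C Q) {v w} (p : Path Q′ v w) →
                    composite (restr m x) p ≡ composite x (mapPath p)
  composite-restr     x (nil v)    = refl
  composite-restr {C} x (cons a p) =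
    trans (cong (λ g → _∘_ C g _) (composite-restr x p))
          (composite-consAlong (amap m a) (src-eq m a) (tgt-eq m a) (mapPath p))
    where
    composite-consAlong : ∀ a {v t w} (e₁ : src Q a ≡ v) (e₂ : tgt Q a ≡ t) (p : Path Q t w) →
      _∘_ C (composite x p) (subst₂ (Hom C) (cong (obj x) e₁) (cong (obj x) e₂) (arr x a))
        ≡ composite x (consAlong a e₁ e₂ p)
    composite-consAlong a refl refl p = refl

module Commerge (Q : Quiver) (Q-acyclic : Acyclic Q)
                {k : ℕ} {Qs : Fin k → Quiver} (Qs-acyclic : ∀ i → Acyclic (Qs i))
                (ms : (i : Fin k) → Embedding (Qs i) Q) where

  data Step {u w : Fin (nV Q)} : Rel (Path Q u w) 0ℓ where
    step : ∀ i {v′ w′} (a : Path Q u (vmap (ms i) v′)) (p′ q′ : Path (Qs i) v′ w′)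
             (b : Path Q (vmap (ms i) w′) w) →
           Step (a ++ₚ mapPath (ms i) p′ ++ₚ b) (a ++ₚ mapPath (ms i) q′ ++ₚ b)

  infix 4 _≈_
  _≈_ : ∀ {u w} → Rel (Path Q u w) 0ℓ
  _≈_ = EqClosure Step

  image-≈ : ∀ i {v′ w′} (p′ q′ : Path (Qs i) v′ w′) → mapPath (ms i) p′ ≈ mapPath (ms i) q′
  image-≈ i p′ q′ =
    subst₂ _≈_ (++ₚ-identityʳ _) (++ₚ-identityʳ _) (EqClosure.return (step i (nil _) p′ q′ (nil _)))

  step-++ₚˡ : ∀ {t u w} (c : Path Q t u) {p q : Path Q u w} → Step p q → Step (c ++ₚ p) (c ++ₚ q)
  step-++ₚˡ c (step i a p′ q′ b) =
    subst₂ Step (++ₚ-assoc c a _) (++ₚ-assoc c a _) (step i (c ++ₚ a) p′ q′ b)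

  step-++ₚʳ : ∀ {u w t} (d : Path Q w t) {p q : Path Q u w} → Step p q → Step (p ++ₚ d) (q ++ₚ d)
  step-++ₚʳ d (step i a p′ q′ b) =
    subst₂ Step (sym (reassociate p′)) (sym (reassociate q′)) (step i a p′ q′ (b ++ₚ d))
    where
    reassociate : ∀ r′ → (a ++ₚ mapPath (ms i) r′ ++ₚ b) ++ₚ d ≡ a ++ₚ mapPath (ms i) r′ ++ₚ b ++ₚ d
    reassociate r′ = trans (++ₚ-assoc a _ d) (cong (a ++ₚ_) (++ₚ-assoc (mapPath (ms i) r′) b d))

  ≈-++ₚ : ∀ {u v w} {p p′ : Path Q u v} {q q′ : Path Q v w} → p ≈ p′ → q ≈ q′ →
          p ++ₚ q ≈ p′ ++ₚ q′
  ≈-++ₚ {p′ = p′} {q} p≈p′ q≈q′ =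
    EqClosure.gmap (_++ₚ q) (step-++ₚʳ q) p≈p′ ◅◅ EqClosure.gmap (p′ ++ₚ_) (step-++ₚˡ p′) q≈q′

  composite-resp-≈ : ∀ {C} (x : Diagram C Q) → (∀ i → Commutes (restr (ms i) x)) →
                     ∀ {u w} {p q : Path Q u w} → p ≈ q → composite x p ≡ composite x q
  composite-resp-≈ x commutes = EqClosure.gfold isEquivalence (composite x) composite-resp-step
    where
    composite-resp-step : ∀ {u w} {p q : Path Q u w} → Step p q → composite x p ≡ composite x q
    composite-resp-step (step i a p′ q′ b) =
      composite-inContext x a b (trans (sym (composite-restr (ms i) x p′))
                                  (trans (commutes i p′ q′) (composite-restr (ms i) x q′)))

  step? : ∀ {u w} → Decidable (Step {u} {w})
  step? {u} {w} p q = map′ toStep fromStep decomposition?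
    where
    paths : ∀ {G} → Acyclic G → ∀ v v′ → Enumerated (Path G v v′)
    paths acyclic = acyclic⇒paths-enumerated acyclic

    Decomposition : Set
    Decomposition =
      ∃[ i ] ∃[ v′ ] ∃[ w′ ] Σ[ a ∈ Path Q u (vmap (ms i) v′) ] Σ[ p′ ∈ Path (Qs i) v′ w′ ]
      Σ[ q′ ∈ Path (Qs i) v′ w′ ] Σ[ b ∈ Path Q (vmap (ms i) w′) w ]
      (p ≡ a ++ₚ mapPath (ms i) p′ ++ₚ b) × (q ≡ a ++ₚ mapPath (ms i) q′ ++ₚ b)

    decomposition? : Dec Decomposition
    decomposition? =
      any? λ i → any? λ v′ → any? λ w′ →
      ∃-enumerated? (paths Q-acyclic _ _) λ a →
      ∃-enumerated? (paths (Qs-acyclic i) _ _) λ p′ →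
      ∃-enumerated? (paths (Qs-acyclic i) _ _) λ q′ →
      ∃-enumerated? (paths Q-acyclic _ _) λ b →
      (p ≟ₚ _) ×-dec (q ≟ₚ _)

    toStep : Decomposition → Step p q
    toStep (i , _ , _ , a , p′ , q′ , b , refl , refl) = step i a p′ q′ b

    fromStep : Step p q → Decomposition
    fromStep (step i a p′ q′ b) = i , _ , _ , a , p′ , q′ , b , refl , refl

  _≈?_ : ∀ {u w} → Decidable (_≈_ {u} {w})
  _≈?_ {u} {w} = FiniteReachability.star? _≟ₚ_ symStep? (acyclic⇒paths-enumerated Q-acyclic u w)
    where
    symStep? : Decidable (SymClosure (Step {u} {w}))
    symStep? p q = map′ (λ { (inj₁ s) → fwd s ; (inj₂ s) → bwd s })
                        (λ { (fwd s) → inj₁ s ; (bwd s) → inj₂ s })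
                        (step? p q ⊎-dec step? q p)

  private
    module Canon {u w : Fin (nV Q)} = CanonicalRepresentative
      (EqClosure.isEquivalence Step) (_≈?_ {u} {w}) (acyclic⇒paths-enumerated Q-acyclic u w)

  -- Opaque, as unfolding the enumeration of all paths makes conversion checking blow up.
  opaque
    canon : ∀ {u w} → Path Q u w → Path Q u w
    canon = Canon.canon

    canon-≈ : ∀ {u w} (p : Path Q u w) → canon p ≈ p
    canon-≈ = Canon.canon-≈

    ≈⇒canon-≡ : ∀ {u w} {p q : Path Q u w} → p ≈ q → canon p ≡ canon q
    ≈⇒canon-≡ = Canon.≈⇒canon-≡

  canon-idempotent : ∀ {u w} (p : Path Q u w) → canon (canon p) ≡ canon p
  canon-idempotent p = ≈⇒canon-≡ (canon-≈ p)

  -- Hom-sets of the free category on Q modulo ≈, with classes given by canonical representatives.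
  CanonicalPath : Fin (nV Q) → Fin (nV Q) → Set
  CanonicalPath u w = Σ[ p ∈ Path Q u w ] canon p ≡ p

  [_] : ∀ {u w} → Path Q u w → CanonicalPath u w
  [ p ] = canon p , canon-idempotent p

  CanonicalPath-≡ : ∀ {u w} {f g : CanonicalPath u w} → proj₁ f ≡ proj₁ g → f ≡ g
  CanonicalPath-≡ {f = p , e} {.p , e′} refl = cong (p ,_) (Decidable⇒UIP.≡-irrelevant _≟ₚ_ e e′)

  []-resp-≈ : ∀ {u w} {p q : Path Q u w} → p ≈ q → [ p ] ≡ [ q ]
  []-resp-≈ p≈q = CanonicalPath-≡ (≈⇒canon-≡ p≈q)

  []≡[]⇒≈ : ∀ {u w} {p q : Path Q u w} → [ p ] ≡ [ q ] → p ≈ q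
  []≡[]⇒≈ {p = p} {q} [p]≡[q] =
    EqClosure.symmetric Step (canon-≈ p) ◅◅ subst (_≈ q) (cong proj₁ (sym [p]≡[q])) (canon-≈ q)

  [proj₁] : ∀ {u w} (f : CanonicalPath u w) → [ proj₁ f ] ≡ f
  [proj₁] (p , canonical) = CanonicalPath-≡ canonical

  []-++ₚ : ∀ {u v w} (p : Path Q u v) (q : Path Q v w) → [ canon p ++ₚ canon q ] ≡ [ p ++ₚ q ]
  []-++ₚ p q = []-resp-≈ (≈-++ₚ (canon-≈ p) (canon-≈ q))

  []-++ₚˡ : ∀ {u v w} (p : Path Q u v) (q : Path Q v w) → [ canon p ++ₚ q ] ≡ [ p ++ₚ q ]
  []-++ₚˡ p q = []-resp-≈ (≈-++ₚ (canon-≈ p) ε)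

  []-++ₚʳ : ∀ {u v w} (p : Path Q u v) (q : Path Q v w) → [ p ++ₚ canon q ] ≡ [ p ++ₚ q ]
  []-++ₚʳ p q = []-resp-≈ (≈-++ₚ ε (canon-≈ q))

  _∘ₚ_ : ∀ {u v w} → CanonicalPath v w → CanonicalPath u v → CanonicalPath u w
  g ∘ₚ f = [ proj₁ f ++ₚ proj₁ g ]

  ∘ₚ-assoc : ∀ {u v w z} (f : CanonicalPath u v) (g : CanonicalPath v w) (h : CanonicalPath w z) →
             (h ∘ₚ g) ∘ₚ f ≡ h ∘ₚ (g ∘ₚ f)
  ∘ₚ-assoc (f , _) (g , _) (h , _) = begin
    [ f ++ₚ canon (g ++ₚ h) ]   ≡⟨ []-++ₚʳ f _ ⟩
    [ f ++ₚ g ++ₚ h ]           ≡⟨ cong [_] (++ₚ-assoc f g h) ⟨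
    [ (f ++ₚ g) ++ₚ h ]         ≡⟨ []-++ₚˡ _ h ⟨
    [ canon (f ++ₚ g) ++ₚ h ]   ∎
    where open ≡-Reasoning

  PathCategory : Category
  PathCategory = record
    { Obj   = Fin (nV Q)
    ; Hom   = CanonicalPath
    ; id    = [ nil _ ]
    ; _∘_   = _∘ₚ_
    ; assoc = ∘ₚ-assoc
    ; idˡ   = λ f → trans ([]-++ₚʳ (proj₁ f) _) (trans (cong [_] (++ₚ-identityʳ _)) ([proj₁] f))
    ; idʳ   = λ f → trans ([]-++ₚˡ (nil _) (proj₁ f)) ([proj₁] f)
    }

  canonicalDiagram : Diagram PathCategory Q
  canonicalDiagram = record { obj = λ v → v ; arr = λ a → [ cons a (nil _) ] }

  composite-canonicalDiagram : ∀ {u w} (p : Path Q u w) → composite canonicalDiagram p ≡ [ p ]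
  composite-canonicalDiagram (nil _)    = refl
  composite-canonicalDiagram (cons a p) =
    trans (cong (_∘ₚ [ cons a (nil (tgt Q a)) ]) (composite-canonicalDiagram p))
          ([]-++ₚ (cons a (nil (tgt Q a))) p)

  canonicalDiagram-restr-commutes : ∀ i → Commutes (restr (ms i) canonicalDiagram)
  canonicalDiagram-restr-commutes i p′ q′ = begin
    composite (restr (ms i) canonicalDiagram) p′  ≡⟨ composite-restr (ms i) canonicalDiagram p′ ⟩
    composite canonicalDiagram (mapPath (ms i) p′) ≡⟨ composite-canonicalDiagram _ ⟩
    [ mapPath (ms i) p′ ]                          ≡⟨ []-resp-≈ (image-≈ i p′ q′) ⟩
    [ mapPath (ms i) q′ ]                          ≡⟨ composite-canonicalDiagram _ ⟨
    composite canonicalDiagram (mapPath (ms i) q′) ≡⟨ composite-restr (ms i) canonicalDiagram q′ ⟨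
    composite (restr (ms i) canonicalDiagram) q′  ∎
    where open ≡-Reasoning

  ParallelPathsRelated : Set
  ParallelPathsRelated = ∀ u w (p q : Path Q u w) → p ≈ q

  valid⇒parallelPathsRelated : CommergeValid ms → ParallelPathsRelated
  valid⇒parallelPathsRelated valid u w p q = []≡[]⇒≈ (begin
    [ p ]                         ≡⟨ composite-canonicalDiagram p ⟨
    composite canonicalDiagram p  ≡⟨ valid PathCategory canonicalDiagram canonicalDiagram-restr-commutes p q ⟩
    composite canonicalDiagram q  ≡⟨ composite-canonicalDiagram q ⟩
    [ q ]                         ∎)
    where open ≡-Reasoning

  parallelPathsRelated⇒valid : ParallelPathsRelated → CommergeValid ms
  parallelPathsRelated⇒valid related C x commutes {u} {w} p q =
    composite-resp-≈ x commutes (related u w p q)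

  parallelPathsRelated? : Dec ParallelPathsRelated
  parallelPathsRelated? =
    all? λ u → all? λ w →
    ∀-enumerated? (acyclic⇒paths-enumerated Q-acyclic u w) λ p →
    ∀-enumerated? (acyclic⇒paths-enumerated Q-acyclic u w) λ q → p ≈? q

theorem18 : (Q : AcyclicQuiver) (k : ℕ) (Qs : Fin k → AcyclicQuiver)
            (ms : (i : Fin k) → Embedding (proj₁ (Qs i)) (proj₁ Q)) →
            Dec (CommergeValid {proj₁ Q} {k} {λ i → proj₁ (Qs i)} ms)
theorem18 (Q , Q-acyclic) k Qs ms =
  map′ parallelPathsRelated⇒valid valid⇒parallelPathsRelated parallelPathsRelated?
  where
  open Commerge Q Q-acyclic (λ i → proj₂ (Qs i)) ms
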